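{- Let $n\ge 1$ and let $F_n$ be the fan graph with vertices $v_0,\dots,v_{2n}$ (edges $v_0v_i$ for $1\le i\le 2n$ and $v_{2j-1}v_{2j}$ for $1\le j\le n$). There is exactly one arithmetical structure $(\mathbf d,\mathbf r)$ on $F_n$ such that $d_0\ge 2n$ and $d_i\ge 2$ for all $1\le i\le 2n$, namely $\mathbf d=(2n,2,2,\dots,2)$ and $\mathbf r=(1,1,\dots,1)$.
   Context: For a finite connected graph $G$ with adjacency matrix $A$, an arithmetical structure on $G$ is a pair $(\mathbf d,\mathbf r)$ of vectors of positive integers indexed by the vertices such that $\mathbf r$ is primitive (gcd of entries equal to $1$) and $(\mathrm{diag}(\mathbf d)-A)\mathbf r=0$. Here $d_i$ is the entry of $\mathbf d$ at $v_i$. -}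

module Defs where

open import Data.Nat using (ℕ; zero; suc; _+_; _*_; _∸_; _≤_; _<_; _/_)
open import Data.Nat.GCD using (gcd)
import Data.Fin as Fin
open import Data.Fin using (Fin; toℕ)
open import Data.Bool using (Bool; true; false; _∧_; not; if_then_else_)
open import Data.Nat using (_≡ᵇ_)
open import Data.List using (List; foldr; map)
open import Data.Nat.ListAction using (sum)
open import Data.List using () renaming (allFin to allFinL)
open import Data.Vec.Functional using (Vector)
open import Data.Product using (_×_)
open import Relation.Binary.PropositionalEquality using (_≡_)

-- A graph on m vertices given by its (symmetric, 0/1) adjacency matrix.
AdjMatrix : ℕ → Set
AdjMatrix m = Fin m → Fin m → ℕ

ΣFin : ∀ {m} → (Fin m → ℕ) → ℕ
ΣFin {m} f = sum (map f (allFinL m))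

gcdAll : ∀ {m} → (Fin m → ℕ) → ℕ
gcdAll {m} r = foldr gcd 0 (map r (allFinL m))

IsArithmeticalStructure : ∀ {m} → AdjMatrix m → (Fin m → ℕ) → (Fin m → ℕ) → Set
IsArithmeticalStructure {m} A d r =
  ((i : Fin m) → 1 ≤ d i) ×
  ((i : Fin m) → 1 ≤ r i) ×
  (gcdAll r ≡ 1) ×
  ((i : Fin m) → d i * r i ≡ ΣFin (λ j → A i j * r j))

-- Fan graph F_n on vertices v_0, …, v_{2n} (represented by Fin (suc (2 * n))):
-- edges v_0 v_i for 1 ≤ i ≤ 2n, and v_{2j-1} v_{2j} for 1 ≤ j ≤ n.
fanAdjB : ℕ → ℕ → Bool
fanAdjB zero zero = false
fanAdjB zero (suc j) = true
fanAdjB (suc i) zero = true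
-- v_{i+1}, v_{j+1} adjacent iff i ≠ j and ⌊i/2⌋ = ⌊j/2⌋ (i.e. {i+1,j+1} = {2k-1,2k})
fanAdjB (suc i) (suc j) = not (i ≡ᵇ j) ∧ ((i / 2) ≡ᵇ (j / 2))

fanAdj : (n : ℕ) → AdjMatrix (suc (2 * n))
fanAdj n i j = if fanAdjB (toℕ i) (toℕ j) then 1 else 0

fanD : (n : ℕ) → Fin (suc (2 * n)) → ℕ
fanD n Fin.zero = 2 * n
fanD n (Fin.suc _) = 2

{-# OPTIONS --safe #-}
-- Write z = r₀. Two adjacent leaves with values a and b satisfy d a = z + b
-- and d′ b = z + a with d, d′ ≥ 2, so 2(a + b) ≤ 2z + a + b, i.e. a + b ≤ 2z.
-- Summing over the n leaf pairs, Σᵢ rᵢ ≤ 2nz ≤ d₀ z = Σᵢ rᵢ, so every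
-- inequality is tight: d₀ = 2n and each pair sums to exactly 2z, which forces
-- a = b = z and d = d′ = 2. Primitivity of r then gives z = 1.
module Submission where

open import Defs
open import Data.Nat using (ℕ; zero; suc; _*_; _≤_)
open import Data.Fin using (Fin; zero; suc)
open import Data.Product using (Σ; _×_; _,_)
open import Relation.Binary.PropositionalEquality using (_≡_)

open import Data.Bool using (if_then_else_)
open import Data.Fin using (toℕ; fromℕ<)
open import Data.Fin.Permutation using (Permutation′; permutation)
open import Data.Fin.Properties using (toℕ-fromℕ<; toℕ<n; toℕ-injective)
open import Data.List using (_∷_; foldr; tabulate)
open import Data.List.Properties using (map-tabulate)
open import Data.Nat using (_+_; _<_; _/_; _≡ᵇ_; z≤n; s≤s; NonZero; >-nonZero)
open import Data.Nat.DivMod using (m/n≡1+[m∸n]/n)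
open import Data.Nat.Divisibility using (_∣_; _∣0; ∣1⇒≡1; ∣-trans; ∣-reflexive)
open import Data.Nat.GCD using (gcd; gcd-greatest; gcd[m,n]∣m; gcd[m,n]∣n)
open import Data.Nat.ListAction using () renaming (sum to sumList)
open import Data.Nat.Properties
open import Algebra.Properties.CommutativeMonoid.Sum +-0-commutativeMonoid
  using (sum; sum-syntax; sum-cong-≗; sum-permute; ∑-distrib-+; sum-replicate-zero)
open import Data.Product using (proj₁; proj₂)
open import Data.Nat.Solver using (module +-*-Solver)
open import Data.List.Membership.Propositional using (_∈_)
open import Data.List.Membership.Propositional.Properties using (∈-map⁺; ∈-allFin)
open import Data.List.Relation.Unary.Any using (here; there)
open import Data.List.Relation.Unary.All using (All; []; _∷_)
open import Data.List.Relation.Unary.All.Properties using (map⁺; tabulate⁺)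
open import Function using (id; _∘_)
open import Relation.Binary.PropositionalEquality
  using (refl; sym; trans; cong; cong₂; subst; module ≡-Reasoning)

open +-*-Solver using (solve; _:=_; _:+_; _:*_; con)

m≤o⇒n≤p⇒m+n≡o+p⇒m≡o×n≡p : ∀ {m n o p} → m ≤ o → n ≤ p → m + n ≡ o + p → m ≡ o × n ≡ p
m≤o⇒n≤p⇒m+n≡o+p⇒m≡o×n≡p {m} {n} {o} {p} m≤o n≤p eq =
  ≤-antisym m≤o (+-cancelʳ-≤ p o m (subst (_≤ m + p) eq (+-monoʳ-≤ m n≤p))) ,
  ≤-antisym n≤p (+-cancelˡ-≤ o p n (subst (_≤ o + n) eq (+-monoˡ-≤ n m≤o)))

∑-const : ∀ m c → ∑[ _ < m ] c ≡ m * c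
∑-const zero    c = refl
∑-const (suc m) c = cong (c +_) (∑-const m c)

∑-mono-≤ : ∀ {m} {f g : Fin m → ℕ} → (∀ i → f i ≤ g i) → sum f ≤ sum g
∑-mono-≤ {zero}  f≤g = z≤n
∑-mono-≤ {suc m} f≤g = +-mono-≤ (f≤g zero) (∑-mono-≤ (f≤g ∘ suc))

∑-mono-≤-≡⇒≗ : ∀ {m} {f g : Fin m → ℕ} → (∀ i → f i ≤ g i) → sum f ≡ sum g → ∀ i → f i ≡ g i
∑-mono-≤-≡⇒≗ {suc m} f≤g eq i
  with m≤o⇒n≤p⇒m+n≡o+p⇒m≡o×n≡p (f≤g zero) (∑-mono-≤ (f≤g ∘ suc)) eq
∑-mono-≤-≡⇒≗ {suc m} f≤g eq zero    | head≡ , _     = head≡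
∑-mono-≤-≡⇒≗ {suc m} f≤g eq (suc i) | _     , tail≡ = ∑-mono-≤-≡⇒≗ (f≤g ∘ suc) tail≡ i

∑-indicator : ∀ {m} (p : Fin m) (g : Fin m → ℕ) →
  sum (λ j → (if toℕ j ≡ᵇ toℕ p then 1 else 0) * g j) ≡ g p
∑-indicator {suc m} zero    g =
  trans (cong (g zero + 0 +_) (sum-replicate-zero m)) (trans (+-identityʳ _) (+-identityʳ _))
∑-indicator {suc m} (suc p) g = ∑-indicator p (g ∘ suc)

ΣFin≡∑ : ∀ {m} (f : Fin m → ℕ) → ΣFin f ≡ sum f
ΣFin≡∑ f = trans (cong sumList (map-tabulate id f)) (sumList-tabulate f)
  where
  sumList-tabulate : ∀ {k} (g : Fin k → ℕ) → sumList (tabulate g) ≡ sum g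
  sumList-tabulate {zero}  g = refl
  sumList-tabulate {suc k} g = cong (g zero +_) (sumList-tabulate (g ∘ suc))

module _ {m} (σ : Fin m → Fin m) (σ-involutive : ∀ i → σ (σ i) ≡ i) where

  ∑-pairs : (f : Fin m → ℕ) → ∑[ i < m ] (f i + f (σ i)) ≡ sum f + sum f
  ∑-pairs f = trans (∑-distrib-+ f (f ∘ σ)) (cong (sum f +_) (sym (sum-permute f π)))
    where
    π : Permutation′ m
    π = permutation σ σ σ-involutive σ-involutive

  module _ {f : Fin m → ℕ} {c : ℕ} (pair≤ : ∀ i → f i + f (σ i) ≤ c + c) where

    ∑-≤-by-pairs : sum f ≤ m * c
    ∑-≤-by-pairs = *-cancelˡ-≤ 2 (begin
      2 * sum f                  ≡⟨ solve 1 (λ x → con 2 :* x := x :+ x) refl (sum f) ⟩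
      sum f + sum f              ≡⟨ ∑-pairs f ⟨
      ∑[ i < m ] (f i + f (σ i)) ≤⟨ ∑-mono-≤ pair≤ ⟩
      ∑[ _ < m ] (c + c)         ≡⟨ ∑-const m (c + c) ⟩
      m * (c + c)                ≡⟨ solve 2 (λ m c → m :* (c :+ c) := con 2 :* (m :* c)) refl m c ⟩
      2 * (m * c)                ∎)
      where open ≤-Reasoning

    pairs-tight : sum f ≡ m * c → ∀ i → f i + f (σ i) ≡ c + c
    pairs-tight ∑f≡ = ∑-mono-≤-≡⇒≗ pair≤ (begin
      ∑[ i < m ] (f i + f (σ i)) ≡⟨ ∑-pairs f ⟩
      sum f + sum f              ≡⟨ cong₂ _+_ ∑f≡ ∑f≡ ⟩
      m * c + m * c              ≡⟨ *-distribˡ-+ m c c ⟨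
      m * (c + c)                ≡⟨ ∑-const m (c + c) ⟨
      ∑[ _ < m ] (c + c)         ∎)
      where open ≡-Reasoning

leaf-pair-≤ : ∀ {d d′ a b z} → 2 ≤ d → 2 ≤ d′ → d * a ≡ z + b → d′ * b ≡ z + a → a + b ≤ z + z
leaf-pair-≤ {d} {d′} {a} {b} {z} 2≤d 2≤d′ eqa eqb = +-cancelʳ-≤ (a + b) (a + b) (z + z) (begin
  (a + b) + (a + b) ≡⟨ solve 2 (λ a b → (a :+ b) :+ (a :+ b) := con 2 :* a :+ con 2 :* b) refl a b ⟩
  2 * a + 2 * b     ≤⟨ +-mono-≤ (*-monoˡ-≤ a 2≤d) (*-monoˡ-≤ b 2≤d′) ⟩
  d * a + d′ * b    ≡⟨ cong₂ _+_ eqa eqb ⟩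
  (z + b) + (z + a) ≡⟨ solve 3 (λ a b z → (z :+ b) :+ (z :+ a) := (z :+ z) :+ (a :+ b)) refl a b z ⟩
  (z + z) + (a + b) ∎)
  where open ≤-Reasoning

leaf-≤-hub : ∀ {d a b z} → 2 ≤ d → d * a ≡ z + b → a + b ≡ z + z → a ≤ z
leaf-≤-hub {d} {a} {b} {z} 2≤d eqa a+b≡ = *-cancelˡ-≤ 3 (begin
  3 * a         ≡⟨ solve 1 (λ a → con 3 :* a := con 2 :* a :+ a) refl a ⟩
  2 * a + a     ≤⟨ +-monoˡ-≤ a (*-monoˡ-≤ a 2≤d) ⟩
  d * a + a     ≡⟨ cong (_+ a) eqa ⟩
  z + b + a     ≡⟨ solve 3 (λ a b z → z :+ b :+ a := z :+ (a :+ b)) refl a b z ⟩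
  z + (a + b)   ≡⟨ cong (z +_) a+b≡ ⟩
  z + (z + z)   ≡⟨ solve 1 (λ z → z :+ (z :+ z) := con 3 :* z) refl z ⟩
  3 * z         ∎)
  where open ≤-Reasoning

leaf-tight : ∀ {d d′ a b z} → .{{NonZero z}} → 2 ≤ d → 2 ≤ d′ →
  d * a ≡ z + b → d′ * b ≡ z + a → a + b ≡ z + z → a ≡ z × d ≡ 2
leaf-tight {d} {d′} {a} {b} {z} 2≤d 2≤d′ eqa eqb a+b≡ = a≡z , d≡2
  where
  a≤z : a ≤ z
  a≤z = leaf-≤-hub 2≤d eqa a+b≡
  b≤z : b ≤ z
  b≤z = leaf-≤-hub 2≤d′ eqb (trans (+-comm b a) a+b≡)
  a≡z×b≡z : a ≡ z × b ≡ z
  a≡z×b≡z = m≤o⇒n≤p⇒m+n≡o+p⇒m≡o×n≡p a≤z b≤z a+b≡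
  a≡z = proj₁ a≡z×b≡z
  b≡z = proj₂ a≡z×b≡z
  d≡2 : d ≡ 2
  d≡2 = *-cancelʳ-≡ d 2 z (begin
    d * z ≡⟨ cong (d *_) a≡z ⟨
    d * a ≡⟨ eqa ⟩
    z + b ≡⟨ cong (z +_) b≡z ⟩
    z + z ≡⟨ solve 1 (λ z → z :+ z := con 2 :* z) refl z ⟩
    2 * z ∎)
    where open ≡-Reasoning

-- Leaf v_{k+1} has index k, so the edge v_{2j+1} v_{2j+2} joins the indices
-- 2j and 2j + 1, and twin swaps them.
twin : ℕ → ℕ
twin zero          = 1
twin (suc zero)    = 0
twin (suc (suc k)) = suc (suc (twin k))

twin-involutive : ∀ k → twin (twin k) ≡ k
twin-involutive zero          = refl
twin-involutive (suc zero)    = refl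
twin-involutive (suc (suc k)) = cong (λ x → 2 + x) (twin-involutive k)

twin-< : ∀ n {k} → k < 2 * n → twin k < 2 * n
twin-< n rewrite *-comm 2 n = twin-<-*2 n
  where
  twin-<-*2 : ∀ n {k} → k < n * 2 → twin k < n * 2
  twin-<-*2 (suc n) {zero}          _                = s≤s (s≤s z≤n)
  twin-<-*2 (suc n) {suc zero}      _                = s≤s z≤n
  twin-<-*2 (suc n) {suc (suc k)} (s≤s (s≤s k<2n)) = s≤s (s≤s (twin-<-*2 n k<2n))

[2+m]/2≡1+m/2 : ∀ m → (2 + m) / 2 ≡ 1 + m / 2
[2+m]/2≡1+m/2 m = m/n≡1+[m∸n]/n {2 + m} (s≤s (s≤s z≤n))

fanAdjB-leaves : ∀ k l → fanAdjB (suc k) (suc l) ≡ (l ≡ᵇ twin k)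
fanAdjB-leaves zero          zero          = refl
fanAdjB-leaves zero          (suc zero)    = refl
fanAdjB-leaves zero          (suc (suc l)) rewrite [2+m]/2≡1+m/2 l = refl
fanAdjB-leaves (suc zero)    zero          = refl
fanAdjB-leaves (suc zero)    (suc zero)    = refl
fanAdjB-leaves (suc zero)    (suc (suc l)) rewrite [2+m]/2≡1+m/2 l = refl
fanAdjB-leaves (suc (suc k)) zero          rewrite [2+m]/2≡1+m/2 k = refl
fanAdjB-leaves (suc (suc k)) (suc zero)    rewrite [2+m]/2≡1+m/2 k = refl
fanAdjB-leaves (suc (suc k)) (suc (suc l)) rewrite [2+m]/2≡1+m/2 k | [2+m]/2≡1+m/2 l = fanAdjB-leaves k l

leafTwin : ∀ n → Fin (2 * n) → Fin (2 * n)
leafTwin n i = fromℕ< (twin-< n (toℕ<n i))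

toℕ-leafTwin : ∀ n (i : Fin (2 * n)) → toℕ (leafTwin n i) ≡ twin (toℕ i)
toℕ-leafTwin n i = toℕ-fromℕ< (twin-< n (toℕ<n i))

leafTwin-involutive : ∀ n (i : Fin (2 * n)) → leafTwin n (leafTwin n i) ≡ i
leafTwin-involutive n i = toℕ-injective (begin
  toℕ (leafTwin n (leafTwin n i)) ≡⟨ toℕ-leafTwin n (leafTwin n i) ⟩
  twin (toℕ (leafTwin n i))       ≡⟨ cong twin (toℕ-leafTwin n i) ⟩
  twin (twin (toℕ i))             ≡⟨ twin-involutive (toℕ i) ⟩
  toℕ i                           ∎)
  where open ≡-Reasoning

fan-hub-row : ∀ n (x : Fin (suc (2 * n)) → ℕ) →
  ΣFin (λ j → fanAdj n zero j * x j) ≡ ∑[ i < 2 * n ] x (suc i)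
fan-hub-row n x =
  trans (ΣFin≡∑ (λ j → fanAdj n zero j * x j)) (sum-cong-≗ (λ i → *-identityˡ (x (suc i))))

fan-leaf-row : ∀ n (i : Fin (2 * n)) (x : Fin (suc (2 * n)) → ℕ) →
  ΣFin (λ j → fanAdj n (suc i) j * x j) ≡ x zero + x (suc (leafTwin n i))
fan-leaf-row n i x = begin
  ΣFin (λ j → fanAdj n (suc i) j * x j)
    ≡⟨ ΣFin≡∑ (λ j → fanAdj n (suc i) j * x j) ⟩
  1 * x zero + ∑[ j < 2 * n ] ((if fanAdjB (suc (toℕ i)) (suc (toℕ j)) then 1 else 0) * x (suc j))
    ≡⟨ cong₂ _+_ (*-identityˡ (x zero)) (sum-cong-≗ adjacent-iff-twin) ⟩
  x zero + ∑[ j < 2 * n ] ((if toℕ j ≡ᵇ toℕ (leafTwin n i) then 1 else 0) * x (suc j))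
    ≡⟨ cong (x zero +_) (∑-indicator (leafTwin n i) (x ∘ suc)) ⟩
  x zero + x (suc (leafTwin n i)) ∎
  where
  open ≡-Reasoning
  adjacent-iff-twin : ∀ j → (if fanAdjB (suc (toℕ i)) (suc (toℕ j)) then 1 else 0) * x (suc j)
                          ≡ (if toℕ j ≡ᵇ toℕ (leafTwin n i) then 1 else 0) * x (suc j)
  adjacent-iff-twin j = cong (λ b → (if b then 1 else 0) * x (suc j))
    (trans (fanAdjB-leaves (toℕ i) (toℕ j)) (cong (toℕ j ≡ᵇ_) (sym (toℕ-leafTwin n i))))

∣-gcdAll : ∀ {m c} (r : Fin m → ℕ) → (∀ i → c ∣ r i) → c ∣ gcdAll r
∣-gcdAll r c∣r = ∣-foldr-gcd (map⁺ (tabulate⁺ c∣r))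
  where
  ∣-foldr-gcd : ∀ {c xs} → All (c ∣_) xs → c ∣ foldr gcd 0 xs
  ∣-foldr-gcd []           = _ ∣0
  ∣-foldr-gcd (c∣x ∷ c∣xs) = gcd-greatest c∣x (∣-foldr-gcd c∣xs)

gcdAll-∣ : ∀ {m} (r : Fin m → ℕ) i → gcdAll r ∣ r i
gcdAll-∣ r i = foldr-gcd-∣ (∈-map⁺ r (∈-allFin i))
  where
  foldr-gcd-∣ : ∀ {x xs} → x ∈ xs → foldr gcd 0 xs ∣ x
  foldr-gcd-∣ (here refl) = gcd[m,n]∣m _ _
  foldr-gcd-∣ {xs = y ∷ _} (there x∈xs) = ∣-trans (gcd[m,n]∣n y _) (foldr-gcd-∣ x∈xs)

fan-structure : ∀ n → 1 ≤ n → IsArithmeticalStructure (fanAdj n) (fanD n) (λ _ → 1)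
fan-structure n 1≤n =
  d-positive , (λ _ → ≤-refl) , ∣1⇒≡1 (gcdAll-∣ {suc (2 * n)} (λ _ → 1) zero) , balanced
  where
  d-positive : ∀ i → 1 ≤ fanD n i
  d-positive zero    = ≤-trans 1≤n (m≤m+n n (n + 0))
  d-positive (suc i) = s≤s z≤n
  balanced : ∀ i → fanD n i * 1 ≡ ΣFin (λ j → fanAdj n i j * 1)
  balanced zero    = sym (trans (fan-hub-row n (λ _ → 1)) (∑-const (2 * n) 1))
  balanced (suc i) = sym (fan-leaf-row n i (λ _ → 1))

module FanUniqueness {n} {d r : Fin (suc (2 * n)) → ℕ}
  (structure : IsArithmeticalStructure (fanAdj n) d r)
  (2n≤d₀ : 2 * n ≤ d zero) (2≤dᵢ : ∀ i → 2 ≤ d (suc i)) where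

  z : ℕ
  z = r zero

  leaf : Fin (2 * n) → ℕ
  leaf i = r (suc i)

  balanced : ∀ i → d i * r i ≡ ΣFin (λ j → fanAdj n i j * r j)
  balanced = proj₂ (proj₂ (proj₂ structure))

  instance
    z≢0 : NonZero z
    z≢0 = >-nonZero (proj₁ (proj₂ structure) zero)

  hub-balance : d zero * z ≡ ∑[ i < 2 * n ] leaf i
  hub-balance = trans (balanced zero) (fan-hub-row n r)

  leaf-balance : ∀ i → d (suc i) * leaf i ≡ z + leaf (leafTwin n i)
  leaf-balance i = trans (balanced (suc i)) (fan-leaf-row n i r)

  twin-balance : ∀ i → d (suc (leafTwin n i)) * leaf (leafTwin n i) ≡ z + leaf i
  twin-balance i = trans (leaf-balance (leafTwin n i)) (cong (λ j → z + leaf j) (leafTwin-involutive n i))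

  pair≤ : ∀ i → leaf i + leaf (leafTwin n i) ≤ z + z
  pair≤ i = leaf-pair-≤ (2≤dᵢ i) (2≤dᵢ (leafTwin n i)) (leaf-balance i) (twin-balance i)

  ∑leaf≡2nz : ∑[ i < 2 * n ] leaf i ≡ 2 * n * z
  ∑leaf≡2nz = ≤-antisym (∑-≤-by-pairs (leafTwin n) (leafTwin-involutive n) pair≤)
                        (subst (2 * n * z ≤_) hub-balance (*-monoˡ-≤ z 2n≤d₀))

  d₀≡2n : d zero ≡ 2 * n
  d₀≡2n = *-cancelʳ-≡ (d zero) (2 * n) z (trans hub-balance ∑leaf≡2nz)

  leaf≡z×dᵢ≡2 : ∀ i → leaf i ≡ z × d (suc i) ≡ 2
  leaf≡z×dᵢ≡2 i = leaf-tight (2≤dᵢ i) (2≤dᵢ (leafTwin n i)) (leaf-balance i) (twin-balance i)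
    (pairs-tight (leafTwin n) (leafTwin-involutive n) pair≤ ∑leaf≡2nz i)

  r≡z : ∀ i → r i ≡ z
  r≡z zero    = refl
  r≡z (suc i) = proj₁ (leaf≡z×dᵢ≡2 i)

  z≡1 : z ≡ 1
  z≡1 = ∣1⇒≡1 (subst (z ∣_) (proj₁ (proj₂ (proj₂ structure)))
                     (∣-gcdAll r (λ i → ∣-reflexive (sym (r≡z i)))))

fan-structure-unique : ∀ n (d r : Fin (suc (2 * n)) → ℕ) → IsArithmeticalStructure (fanAdj n) d r →
  2 * n ≤ d zero → (∀ i → 2 ≤ d (suc i)) →
  d zero ≡ 2 * n × (∀ i → d (suc i) ≡ 2) × (∀ i → r i ≡ 1)
fan-structure-unique n d r structure 2n≤d₀ 2≤dᵢ =
  d₀≡2n , (λ i → proj₂ (leaf≡z×dᵢ≡2 i)) , (λ i → trans (r≡z i) z≡1)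
  where open FanUniqueness {n} structure 2n≤d₀ 2≤dᵢ

mainTheorem3 : (n : ℕ) → 1 ≤ n →
    -- (2n, 2, …, 2), (1, …, 1) is such a structure
    (IsArithmeticalStructure (fanAdj n)
        (fanD n) (λ _ → 1))
    ×
    -- and it is the only one with d_0 ≥ 2n and d_i ≥ 2 for 1 ≤ i ≤ 2n
    ((d r : Fin (suc (2 * n)) → ℕ) →
      IsArithmeticalStructure (fanAdj n) d r →
      2 * n ≤ d zero →
      ((i : Fin (2 * n)) → 2 ≤ d (suc i)) →
      (d zero ≡ 2 * n) × ((i : Fin (2 * n)) → d (suc i) ≡ 2) ×
      ((i : Fin (suc (2 * n))) → r i ≡ 1))
mainTheorem3 n 1≤n = fan-structure n 1≤n , fan-structure-unique n
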